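{- The Petersen graph $\mathbb{P}$ is $\theta$-free, and for any two distinct vertices $u,v$ of $\mathbb{P}$, the graph $\mathbb{P}+uv$ obtained by adding a new edge joining $u$ and $v$ is $\theta$-based.
   Context: Graphs are loopless; multiple edges allowed. $\theta$ is two vertices joined by three parallel edges. A subgraph $H$ of $G$ is conformal if $G-V(H)$ has a perfect matching; a bisubdivision of $\theta$ is obtained by replacing some of its edges by paths with an even number of internal vertices; a matching covered graph is $\theta$-based if it has a conformal subgraph that is a bisubdivision of $\theta$, and $\theta$-free otherwise. -}

module Defs where

open import Data.Nat using (ℕ; zero; suc; _≤_)
open import Data.Nat.Divisibility using (_∣_)
open import Data.Fin using (Fin; zero; suc)
open import Data.Product using (_×_; _,_; proj₁; proj₂; Σ; ∃; ∃-syntax)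
open import Data.Sum using (_⊎_)
open import Data.List using (List; []; _∷_; _++_; length)
open import Data.List.Membership.Propositional using (_∈_)
open import Data.List.Relation.Unary.Unique.Propositional using (Unique)
open import Data.Vec using (Vec; lookup; []; _∷_)
open import Relation.Binary.PropositionalEquality using (_≡_; _≢_)
open import Relation.Nullary using (¬_)
open import Data.Bool using (Bool; true)
open import Data.Empty using (⊥)
open import Data.Fin using (#_)

-- A finite loopless multigraph: vertices Fin n, edges Fin m, each edge with
-- two (distinct) ends. Parallel edges are allowed (distinct edge labels).
record Graph : Set where
  field
    n : ℕ
    m : ℕ
    ends : Fin m → Fin n × Fin n
    loopless : ∀ e → proj₁ (ends e) ≢ proj₂ (ends e)

module _ (G : Graph) where
  open Graph G

  Incident : Fin m → Fin n → Set
  Incident e v = proj₁ (ends e) ≡ v ⊎ proj₂ (ends e) ≡ v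

  Joins : Fin m → Fin n → Fin n → Set
  Joins e x y = ends e ≡ (x , y) ⊎ ends e ≡ (y , x)

  IsPerfectMatchingOfMinus : (Fin n → Set) → (Fin m → Bool) → Set
  IsPerfectMatchingOfMinus S M =
    (∀ e → M e ≡ true → ¬ S (proj₁ (ends e)) × ¬ S (proj₂ (ends e))) ×
    (∀ v → ¬ S v → Σ (Fin m) λ e → M e ≡ true × Incident e v ×
                     (∀ e' → M e' ≡ true → Incident e' v → e' ≡ e))

  IsPerfectMatching : (Fin m → Bool) → Set
  IsPerfectMatching M = IsPerfectMatchingOfMinus (λ _ → ⊥) M

  data Walk : Fin n → Fin n → Set where
    here : ∀ {x} → Walk x x
    step : ∀ {x y z} (e : Fin m) → Joins e x y → Walk y z → Walk x z

  Connected : Set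
  Connected = ∀ u v → Walk u v

  MatchingCovered : Set
  MatchingCovered = Connected × (2 ≤ n) ×
    (∀ e → Σ (Fin m → Bool) λ M → IsPerfectMatching M × M e ≡ true)

  -- Trail x y is es : a walk from x to y using the edge list es, whose
  -- internal vertices (in order) are is.
  data Trail : Fin n → Fin n → List (Fin n) → List (Fin m) → Set where
    one  : ∀ {x y} (e : Fin m) → Joins e x y → Trail x y [] (e ∷ [])
    more : ∀ {x y z is es} (e : Fin m) → Joins e x z → Trail z y is es →
           Trail x y (z ∷ is) (e ∷ es)

  record ThetaBisubdivision : Set where
    field
      a b : Fin n
      is₁ is₂ is₃ : List (Fin n)
      es₁ es₂ es₃ : List (Fin m)
      path₁ : Trail a b is₁ es₁
      path₂ : Trail a b is₂ es₂
      path₃ : Trail a b is₃ es₃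
      even₁ : 2 ∣ length is₁
      even₂ : 2 ∣ length is₂
      even₃ : 2 ∣ length is₃
      vertsDistinct : Unique (a ∷ b ∷ is₁ ++ is₂ ++ is₃)
      edgesDistinct : Unique (es₁ ++ es₂ ++ es₃)

    vertices : List (Fin n)
    vertices = a ∷ b ∷ is₁ ++ is₂ ++ is₃

  Conformal : ThetaBisubdivision → Set
  Conformal H = Σ (Fin m → Bool) λ M →
    IsPerfectMatchingOfMinus (λ v → v ∈ ThetaBisubdivision.vertices H) M

  HasConformalThetaBisubdivision : Set
  HasConformalThetaBisubdivision = Σ ThetaBisubdivision Conformal

  ThetaBased : Set
  ThetaBased = MatchingCovered × HasConformalThetaBisubdivision

  ThetaFree : Set
  ThetaFree = MatchingCovered × ¬ HasConformalThetaBisubdivision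

addEdge : (G : Graph) (u v : Fin (Graph.n G)) → u ≢ v → Graph
addEdge G u v u≢v = record
  { n = Graph.n G
  ; m = suc (Graph.m G)
  ; ends = ends'
  ; loopless = ll
  }
  where
    ends' : Fin (suc (Graph.m G)) → Fin (Graph.n G) × Fin (Graph.n G)
    ends' zero = (u , v)
    ends' (suc e) = Graph.ends G e
    ll : ∀ e → proj₁ (ends' e) ≢ proj₂ (ends' e)
    ll zero = u≢v
    ll (suc e) = Graph.loopless G e

-- The Petersen graph: outer 5-cycle 0-1-2-3-4-0, spokes i-(i+5),
-- inner pentagram (i+5)-((i+2 mod 5)+5).
petersenEdges : Vec (Fin 10 × Fin 10) 15
petersenEdges =
  (# 0 , # 1) ∷ (# 1 , # 2) ∷ (# 2 , # 3) ∷ (# 3 , # 4) ∷ (# 4 , # 0) ∷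
  (# 0 , # 5) ∷ (# 1 , # 6) ∷ (# 2 , # 7) ∷ (# 3 , # 8) ∷ (# 4 , # 9) ∷
  (# 5 , # 7) ∷ (# 7 , # 9) ∷ (# 9 , # 6) ∷ (# 6 , # 8) ∷ (# 8 , # 5) ∷ []

private
  petersenLoopless : ∀ e → proj₁ (lookup petersenEdges e) ≢ proj₂ (lookup petersenEdges e)
  petersenLoopless zero = λ ()
  petersenLoopless (suc zero) = λ ()
  petersenLoopless (suc (suc zero)) = λ ()
  petersenLoopless (suc (suc (suc zero))) = λ ()
  petersenLoopless (suc (suc (suc (suc zero)))) = λ ()
  petersenLoopless (suc (suc (suc (suc (suc zero))))) = λ ()
  petersenLoopless (suc (suc (suc (suc (suc (suc zero)))))) = λ ()
  petersenLoopless (suc (suc (suc (suc (suc (suc (suc zero))))))) = λ ()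
  petersenLoopless (suc (suc (suc (suc (suc (suc (suc (suc zero)))))))) = λ ()
  petersenLoopless (suc (suc (suc (suc (suc (suc (suc (suc (suc zero))))))))) = λ ()
  petersenLoopless (suc (suc (suc (suc (suc (suc (suc (suc (suc (suc zero)))))))))) = λ ()
  petersenLoopless (suc (suc (suc (suc (suc (suc (suc (suc (suc (suc (suc zero))))))))))) = λ ()
  petersenLoopless (suc (suc (suc (suc (suc (suc (suc (suc (suc (suc (suc (suc zero)))))))))))) = λ ()
  petersenLoopless (suc (suc (suc (suc (suc (suc (suc (suc (suc (suc (suc (suc (suc zero))))))))))))) = λ ()
  petersenLoopless (suc (suc (suc (suc (suc (suc (suc (suc (suc (suc (suc (suc (suc (suc zero)))))))))))))) = λ ()

Petersen : Graph
Petersen = record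
  { n = 10 ; m = 15 ; ends = lookup petersenEdges ; loopless = petersenLoopless }

-- A θ-bisubdivision of a simple graph consists of three internally disjoint a–b paths of odd
-- length, at most one of which is a single edge. A depth-first enumeration of the paths of ℙ shows
-- that no such triple exists, so ℙ has no θ-bisubdivision at all, conformal or not; ℙ is matching
-- covered because its six perfect matchings cover every edge. In ℙ + uv these matchings survive,
-- and one more perfect matching through uv makes it matching covered; a conformal θ-bisubdivision
-- of ℙ + uv, together with a perfect matching of its complement, is exhibited for each of the 45
-- pairs {u, v} and checked by decision procedures.
module Submission where

open import Defs
open import Agda.Builtin.FromNat using (Number; fromNat)
open import Data.Bool using (Bool; true; false; if_then_else_)
open import Data.Bool.Properties using () renaming (_≟_ to _≟ᵇ_)
open import Data.Empty using (⊥-elim)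
open import Data.Fin using (Fin; zero; suc)
import Data.Fin.Literals as Fin
open import Data.Fin.Patterns using (0F; 1F; 2F; 3F; 4F; 5F; 6F; 7F; 8F; 9F)
open import Data.Fin.Properties using (_≟_; all?; any?; injective⇒≤)
open import Data.List using (List; []; _∷_; _++_; [_]; length; map; concatMap; lookup)
open import Data.List.Properties using (++-assoc)
import Data.List.Properties as List
open import Data.List.Membership.Propositional using (_∈_; _∉_)
open import Data.List.Membership.Propositional.Properties
  using (∈-++⁺ˡ; ∈-++⁺ʳ; ∈-map⁺; ∈-concatMap⁺; ∈-lookup)
import Data.List.Membership.DecPropositional as DecMembership
open import Data.List.Relation.Unary.All as All using (All; []; _∷_)
import Data.List.Relation.Unary.All.Properties as All
open import Data.List.Relation.Unary.Any as Any using (Any; here; there)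
open import Data.List.Relation.Unary.AllPairs using ([]; _∷_)
open import Data.List.Relation.Unary.Unique.Propositional using (Unique)
open import Data.List.Relation.Unary.Unique.DecPropositional using (unique?)
open import Data.Nat using (ℕ; zero; suc; _≤_; _<_; z≤n; s≤s)
import Data.Nat.Literals as ℕ
open import Data.Nat.Divisibility using (_∣_; _∣?_)
open import Data.Product using (Σ; _×_; _,_; proj₁; proj₂; ∃)
open import Data.Product.Properties using (≡-dec)
open import Data.Sum using (inj₁; inj₂) renaming (swap to ⊎-swap)
open import Data.Unit using (tt) -- solves the ⊤ constraints of ℕ literals by instance search
open import Relation.Binary.Definitions using (DecidableEquality)
open import Relation.Binary.PropositionalEquality using (_≡_; _≢_; refl; sym; cong; subst)
open import Relation.Nullary using (¬_; Dec; yes; no; does; ¬?)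
open import Relation.Nullary.Decidable
  using (from-yes; map′; _×-dec_; _⊎-dec_; _→-dec_; dec-true; dec-false)

instance
  ℕ-literals : Number ℕ
  ℕ-literals = ℕ.number

  Fin-literals : ∀ {n} → Number (Fin n)
  Fin-literals = Fin.number _

∉-∷⁺ : ∀ {A : Set} {x y : A} {xs} → x ≢ y × y ∉ xs → y ∉ x ∷ xs
∉-∷⁺ (x≢y , _)    (here y≡x) = x≢y (sym y≡x)
∉-∷⁺ (_   , y∉xs) (there y∈) = y∉xs y∈

∈-concatMap⁺′ : ∀ {A B : Set} {f : A → List B} {xs x w} → w ∈ f x → x ∈ xs → w ∈ concatMap f xs
∈-concatMap⁺′ {f = f} w∈fx x∈xs = ∈-concatMap⁺ f (Any.map (λ { refl → w∈fx }) x∈xs)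

unique-++⁻ˡ : ∀ {A : Set} (xs : List A) {ys} → Unique (xs ++ ys) → Unique xs
unique-++⁻ˡ []       _        = []
unique-++⁻ˡ (x ∷ xs) (x∉ ∷ u) = All.++⁻ˡ xs x∉ ∷ unique-++⁻ˡ xs u

unique-++⁻ʳ : ∀ {A : Set} (xs : List A) {ys} → Unique (xs ++ ys) → Unique ys
unique-++⁻ʳ []       u       = u
unique-++⁻ʳ (x ∷ xs) (_ ∷ u) = unique-++⁻ʳ xs u

unique-++⇒disjoint : ∀ {A : Set} (xs : List A) {ys} → Unique (xs ++ ys) → All (_∉ xs) ys
unique-++⇒disjoint []       _        = All.universal (λ _ ()) _
unique-++⇒disjoint (x ∷ xs) (x∉ ∷ u) =
  All.zipWith ∉-∷⁺ (All.++⁻ʳ xs x∉ , unique-++⇒disjoint xs u)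

unique⇒length≤ : ∀ {n} {xs : List (Fin n)} → Unique xs → length xs ≤ n
unique⇒length≤ u = injective⇒≤ (lookup-injective u)
  where
  lookup-injective : ∀ {n} {xs : List (Fin n)} → Unique xs →
                     ∀ {i j} → lookup xs i ≡ lookup xs j → i ≡ j
  lookup-injective (_  ∷ _) {zero}  {zero}  _  = refl
  lookup-injective (x∉ ∷ _) {zero}  {suc j} eq = ⊥-elim (All.lookup x∉ (∈-lookup j) eq)
  lookup-injective (x∉ ∷ _) {suc i} {zero}  eq = ⊥-elim (All.lookup x∉ (∈-lookup i) (sym eq))
  lookup-injective (_  ∷ u) {suc i} {suc j} eq = cong suc (lookup-injective u eq)

edgeSet : ∀ {m} → List (Fin m) → Fin m → Bool
edgeSet es e = does (DecMembership._∈?_ _≟_ e es)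

CoveredOnceBy : (G : Graph) → (Fin (Graph.m G) → Bool) → Fin (Graph.n G) → Set
CoveredOnceBy G M x = Σ (Fin (Graph.m G)) λ e →
  M e ≡ true × Incident G e x × (∀ e′ → M e′ ≡ true → Incident G e′ x → e′ ≡ e)

module _ (G : Graph) where
  open Graph G

  _◅◅_ : ∀ {x y z} → Walk G x y → Walk G y z → Walk G x z
  here       ◅◅ w′ = w′
  step e j w ◅◅ w′ = step e j (w ◅◅ w′)

  reverse-walk : ∀ {x y} → Walk G x y → Walk G y x
  reverse-walk here         = here
  reverse-walk (step e j w) = reverse-walk w ◅◅ step e (⊎-swap j) here

  connected-from : ∀ r → (∀ x → Walk G r x) → Connected G
  connected-from r walk x y = reverse-walk (walk x) ◅◅ walk y

  joins? : ∀ e x y → Dec (Joins G e x y)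
  joins? e x y = (ends e ≟ₚ (x , y)) ⊎-dec (ends e ≟ₚ (y , x))
    where
    _≟ₚ_ : DecidableEquality (Fin n × Fin n)
    _≟ₚ_ = ≡-dec _≟_ _≟_

  incident? : ∀ e x → Dec (Incident G e x)
  incident? e x = (proj₁ (ends e) ≟ x) ⊎-dec (proj₂ (ends e) ≟ x)

  trail? : ∀ x y is es → Dec (Trail G x y is es)
  trail? x y []       (e ∷ [])    = map′ (one e) (λ { (one _ j) → j }) (joins? e x y)
  trail? x y (z ∷ is) (e ∷ es)    = map′ (λ (j , t) → more e j t) (λ { (more _ j t) → j , t })
                                         (joins? e x z ×-dec trail? z y is es)
  trail? x y []       []          = no λ ()
  trail? x y []       (_ ∷ _ ∷ _) = no λ ()
  trail? x y (_ ∷ _)  []          = no λ ()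

  perfectMatchingOfMinus? : ∀ {S} → (∀ x → Dec (S x)) → ∀ M → Dec (IsPerfectMatchingOfMinus G S M)
  perfectMatchingOfMinus? S? M =
    (all? λ e → (M e ≟ᵇ true) →-dec (¬? (S? (proj₁ (ends e))) ×-dec ¬? (S? (proj₂ (ends e)))))
    ×-dec
    (all? λ x → ¬? (S? x) →-dec coveredOnce? x)
    where
    coveredOnce? : ∀ x → Dec (CoveredOnceBy G M x)
    coveredOnce? x = any? λ e → (M e ≟ᵇ true) ×-dec incident? e x ×-dec
      (all? λ e′ → (M e′ ≟ᵇ true) →-dec (incident? e′ x →-dec e′ ≟ e))

  perfectMatching? : ∀ M → Dec (IsPerfectMatching G M)
  perfectMatching? = perfectMatchingOfMinus? (λ _ → no λ ())

record ThetaCertificate (n m : ℕ) : Set where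
  constructor certificate
  field
    a b                : Fin n
    is₁ is₂ is₃        : List (Fin n)
    es₁ es₂ es₃        : List (Fin m)
    complementMatching : List (Fin m)

  vertices : List (Fin n)
  vertices = a ∷ b ∷ is₁ ++ is₂ ++ is₃

module _ (G : Graph) where
  open Graph G

  Certifies : ThetaCertificate n m → Set
  Certifies c =
    Trail G a b is₁ es₁ × Trail G a b is₂ es₂ × Trail G a b is₃ es₃ ×
    2 ∣ length is₁ × 2 ∣ length is₂ × 2 ∣ length is₃ ×
    Unique vertices × Unique (es₁ ++ es₂ ++ es₃) ×
    IsPerfectMatchingOfMinus G (_∈ vertices) (edgeSet complementMatching)
    where open ThetaCertificate c

  certifies? : ∀ c → Dec (Certifies c)
  certifies? c =
    trail? G a b is₁ es₁ ×-dec trail? G a b is₂ es₂ ×-dec trail? G a b is₃ es₃ ×-dec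
    2 ∣? length is₁ ×-dec 2 ∣? length is₂ ×-dec 2 ∣? length is₃ ×-dec
    unique? _≟_ vertices ×-dec unique? _≟_ (es₁ ++ es₂ ++ es₃) ×-dec
    perfectMatchingOfMinus? G (λ x → DecMembership._∈?_ _≟_ x vertices) (edgeSet complementMatching)
    where open ThetaCertificate c

  certified-conformalTheta : ∀ {c} → Certifies c → HasConformalThetaBisubdivision G
  certified-conformalTheta {c} (p₁ , p₂ , p₃ , d₁ , d₂ , d₃ , uv , ue , pm) =
    record { ThetaCertificate c
           ; path₁ = p₁ ; path₂ = p₂ ; path₃ = p₃
           ; even₁ = d₁ ; even₂ = d₂ ; even₃ = d₃
           ; vertsDistinct = uv ; edgesDistinct = ue }
    , edgeSet (ThetaCertificate.complementMatching c) , pm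

module _ (G : Graph) {u v : Fin (Graph.n G)} (u≢v : u ≢ v) where
  open Graph G

  private
    G⁺ : Graph
    G⁺ = addEdge G u v u≢v

  lift-walk : ∀ {x y} → Walk G x y → Walk G⁺ x y
  lift-walk here         = here
  lift-walk (step e j w) = step (suc e) j (lift-walk w)

  lift-matching : (Fin m → Bool) → Fin (suc m) → Bool
  lift-matching M zero    = false
  lift-matching M (suc e) = M e

  lift-coveredOnce : ∀ {M x} → CoveredOnceBy G M x → CoveredOnceBy G⁺ (lift-matching M) x
  lift-coveredOnce {M} {x} (e , Me , e∋x , only-e) = suc e , Me , e∋x , only-suc-e
    where
    only-suc-e : ∀ e′ → lift-matching M e′ ≡ true → Incident G⁺ e′ x → e′ ≡ suc e
    only-suc-e zero     ()
    only-suc-e (suc e′) Me′ e′∋x = cong suc (only-e e′ Me′ e′∋x)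

  lift-perfectMatching : ∀ {M} → IsPerfectMatching G M → IsPerfectMatching G⁺ (lift-matching M)
  lift-perfectMatching (_ , covered) =
    (λ _ _ → (λ ()) , (λ ())) , λ x _ → lift-coveredOnce (covered x (λ ()))

  addEdge-matchingCovered : MatchingCovered G → ∀ M → IsPerfectMatching G⁺ M → M zero ≡ true →
                            MatchingCovered G⁺
  addEdge-matchingCovered (connected , 2≤n , covered) M pm uv∈M =
    (λ x y → lift-walk (connected x y)) , 2≤n , covered⁺
    where
    covered⁺ : ∀ e → ∃ λ M → IsPerfectMatching G⁺ M × M e ≡ true
    covered⁺ zero    = M , pm , uv∈M
    covered⁺ (suc e) with covered e
    ... | M′ , pm′ , e∈M′ = lift-matching M′ , lift-perfectMatching pm′ , e∈M′

  record CertifiesThetaBased (w : ThetaCertificate n (suc m) × List (Fin (suc m))) : Set where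
    constructor certified
    field
      theta   : Certifies G⁺ (proj₁ w)
      perfect : IsPerfectMatching G⁺ (edgeSet (proj₂ w))
      uv∈M    : edgeSet (proj₂ w) zero ≡ true

  certifiesThetaBased? : ∀ w → Dec (CertifiesThetaBased w)
  certifiesThetaBased? (c , M) =
    map′ (λ (θ , pm , uv∈M) → certified θ pm uv∈M) (λ (certified θ pm uv∈M) → θ , pm , uv∈M)
      (certifies? G⁺ c ×-dec perfectMatching? G⁺ (edgeSet M) ×-dec (edgeSet M zero ≟ᵇ true))

  certified-thetaBased : MatchingCovered G → ∀ {w} → CertifiesThetaBased w → ThetaBased G⁺
  certified-thetaBased mc {c , M} (certified θ pm uv∈M) =
    addEdge-matchingCovered mc (edgeSet M) pm uv∈M , certified-conformalTheta G⁺ {c} θ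

-- The proof of u ≢ v only feeds the loopless field of G + uv, so Joins and perfect matchings do
-- not depend on it definitionally; only the data types indexed by the graph need transporting.
module _ (G : Graph) {u v : Fin (Graph.n G)} {p q : u ≢ v} where

  addEdge-trail-irrelevant : ∀ {x y is es} →
                             Trail (addEdge G u v p) x y is es → Trail (addEdge G u v q) x y is es
  addEdge-trail-irrelevant (one e j)    = one e j
  addEdge-trail-irrelevant (more e j t) = more e j (addEdge-trail-irrelevant t)

  certifiesThetaBased-irrelevant : ∀ {w} → CertifiesThetaBased G p w → CertifiesThetaBased G q w
  certifiesThetaBased-irrelevant (certified (p₁ , p₂ , p₃ , rest) pm uv∈M) =
    certified (addEdge-trail-irrelevant p₁ , addEdge-trail-irrelevant p₂ ,
               addEdge-trail-irrelevant p₃ , rest) pm uv∈M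

∀≢? : ∀ {n} {P : (x y : Fin n) → x ≢ y → Set} → (∀ {x y p q} → P x y p → P x y q) →
      (∀ {x y} p → Dec (P x y p)) → Dec (∀ x y p → P x y p)
∀≢? {P = P} irrelevant P? = all? λ x → all? λ y → guarded x y
  where
  guarded : ∀ x y → Dec (∀ p → P x y p)
  guarded x y with x ≟ y
  ... | yes x≡y = yes λ x≢y → ⊥-elim (x≢y x≡y)
  ... | no  x≢y = map′ (λ Px≢y _ → irrelevant Px≢y) (λ P → P x≢y) (P? x≢y)

-- The last three conjuncts hold for the internal vertex lists of a θ-bisubdivision of a simple
-- graph, where two one-edge paths between the same ends would share their edge.
ThetaShaped : ∀ {n} → List (Fin n) → List (Fin n) → List (Fin n) → Set
ThetaShaped i j k =
  2 ∣ length i × 2 ∣ length j × 2 ∣ length k ×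
  ¬ (i ≡ [] × j ≡ []) × ¬ (i ≡ [] × k ≡ []) × ¬ (j ≡ [] × k ≡ [])

thetaShaped? : ∀ {n} (i j k : List (Fin n)) → Dec (ThetaShaped i j k)
thetaShaped? {n} i j k =
  2 ∣? length i ×-dec 2 ∣? length j ×-dec 2 ∣? length k ×-dec
  ¬? (i ≟ₗ [] ×-dec j ≟ₗ []) ×-dec ¬? (i ≟ₗ [] ×-dec k ≟ₗ []) ×-dec
  ¬? (j ≟ₗ [] ×-dec k ≟ₗ [])
  where
  _≟ₗ_ : DecidableEquality (List (Fin n))
  _≟ₗ_ = List.≡-dec _≟_

module _ {n} (neighbours : Fin n → List (Fin n)) where
  open DecMembership (_≟_ {n}) using (_∈?_)

  mutual
    paths : ℕ → List (Fin n) → Fin n → Fin n → List (List (Fin n))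
    paths zero    F x y = []
    paths (suc k) F x y = concatMap (continue k F y) (neighbours x)

    continue : ℕ → List (Fin n) → Fin n → Fin n → List (List (Fin n))
    continue k F y z =
      (if does (z ≟ y) then [ [] ] else []) ++
      (if does (z ∈? F) then [] else map (z ∷_) (paths k (z ∷ F) z y))

  pathsAvoiding : List (Fin n) → Fin n → Fin n → List (List (Fin n))
  pathsAvoiding = paths (suc n)

  NoThetaShapes : Set
  NoThetaShapes = ∀ a b →
    All (λ i → All (λ j → All (λ k → ¬ ThetaShaped i j k)
      (pathsAvoiding (a ∷ b ∷ i ++ j) a b))
      (pathsAvoiding (a ∷ b ∷ i) a b))
      (pathsAvoiding (a ∷ b ∷ []) a b)

  noThetaShapes? : Dec NoThetaShapes
  noThetaShapes? = all? λ a → all? λ b →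
    All.all? (λ i → All.all? (λ j → All.all? (λ k → ¬? (thetaShaped? i j k)) _) _) _

module _ (G : Graph) where
  open Graph G

  ListsNeighbours : (Fin n → List (Fin n)) → Set
  ListsNeighbours N = ∀ e x y → Joins G e x y → y ∈ N x

  listsNeighbours? : ∀ N → Dec (ListsNeighbours N)
  listsNeighbours? N = all? λ e → all? λ x → all? λ y →
    joins? G e x y →-dec DecMembership._∈?_ _≟_ y (N x)

  module _ {N} (N-lists : ListsNeighbours N) where
    open DecMembership (_≟_ {n}) using (_∈?_)

    paths-complete : ∀ {k F x y is es} → Trail G x y is es → Unique is → All (_∉ F) is →
                     length is < k → is ∈ paths N k F x y
    paths-complete {suc k} {F} {x} {y} (one e j) _ _ _ =
      ∈-concatMap⁺′ (∈-++⁺ˡ ([]∈ (y ≟ y) refl)) (N-lists e x y j)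
      where
      []∈ : (y≟y : Dec (y ≡ y)) → y ≡ y → [] ∈ (if does y≟y then [ [] ] else [])
      []∈ y≟y y≡y rewrite dec-true y≟y y≡y = here refl
    paths-complete {suc k} {F} {x} {y} (more {z = z} {is = is} e j t)
                   (z∉is ∷ u) (z∉F ∷ avoid) (s≤s len) =
      ∈-concatMap⁺′ (∈-++⁺ʳ _ (z∷is∈ (z ∈? F) z∉F)) (N-lists e x z j)
      where
      z∷is∈ : (z∈?F : Dec (z ∈ F)) → z ∉ F →
              z ∷ is ∈ (if does z∈?F then [] else map (z ∷_) (paths N k (z ∷ F) z y))
      z∷is∈ z∈?F z∉F rewrite dec-false z∈?F z∉F =
        ∈-map⁺ (z ∷_) (paths-complete t u (All.zipWith ∉-∷⁺ (z∉is , avoid)) len)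

    pathsAvoiding-complete : ∀ F {x y is es} → Trail G x y is es → Unique (F ++ is) →
                             is ∈ pathsAvoiding N F x y
    pathsAvoiding-complete F {is = is} t u =
      paths-complete t unique-is (unique-++⇒disjoint F u) (s≤s (unique⇒length≤ unique-is))
      where
      unique-is : Unique is
      unique-is = unique-++⁻ʳ F u

  Simple : Set
  Simple = ∀ e e′ → Joins G e′ (proj₁ (ends e)) (proj₂ (ends e)) → e′ ≡ e

  simple? : Dec Simple
  simple? = all? λ e → all? λ e′ → joins? G e′ _ _ →-dec e′ ≟ e

  simple-joins-unique : Simple → ∀ {e e′ x y} → Joins G e x y → Joins G e′ x y → e′ ≡ e
  simple-joins-unique simple {e} {e′} (inj₁ e≡xy) j′ =
    simple e e′ (subst (λ xy → Joins G e′ (proj₁ xy) (proj₂ xy)) (sym e≡xy) j′)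
  simple-joins-unique simple {e} {e′} (inj₂ e≡yx) j′ =
    simple e e′ (subst (λ yx → Joins G e′ (proj₁ yx) (proj₂ yx)) (sym e≡yx) (⊎-swap j′))

  noThetaBisubdivision : Simple → ∀ {N} → ListsNeighbours N → NoThetaShapes N →
                         ¬ ThetaBisubdivision G
  noThetaBisubdivision simple {N} N-lists none H =
    All.lookup (All.lookup (All.lookup (none a b) is₁∈) is₂∈) is₃∈
      ( even₁ , even₂ , even₃
      , notBothDirect (All.++⁻ˡ es₂ es₁#es₂₃) path₁ path₂
      , notBothDirect (All.++⁻ʳ es₂ es₁#es₂₃) path₁ path₃
      , notBothDirect (unique-++⇒disjoint es₂ (unique-++⁻ʳ es₁ edgesDistinct)) path₂ path₃ )
    where
    open ThetaBisubdivision H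
    unique₃ : Unique ((a ∷ b ∷ is₁ ++ is₂) ++ is₃)
    unique₃ = subst (λ is → Unique (a ∷ b ∷ is)) (sym (++-assoc is₁ is₂ is₃)) vertsDistinct
    unique₂ : Unique ((a ∷ b ∷ is₁) ++ is₂)
    unique₂ = unique-++⁻ˡ (a ∷ b ∷ is₁ ++ is₂) unique₃
    is₁∈ : is₁ ∈ pathsAvoiding N (a ∷ b ∷ []) a b
    is₁∈ = pathsAvoiding-complete N-lists (a ∷ b ∷ []) path₁ (unique-++⁻ˡ (a ∷ b ∷ is₁) unique₂)
    is₂∈ : is₂ ∈ pathsAvoiding N (a ∷ b ∷ is₁) a b
    is₂∈ = pathsAvoiding-complete N-lists (a ∷ b ∷ is₁) path₂ unique₂
    is₃∈ : is₃ ∈ pathsAvoiding N (a ∷ b ∷ is₁ ++ is₂) a b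
    is₃∈ = pathsAvoiding-complete N-lists (a ∷ b ∷ is₁ ++ is₂) path₃ unique₃
    es₁#es₂₃ : All (_∉ es₁) (es₂ ++ es₃)
    es₁#es₂₃ = unique-++⇒disjoint es₁ edgesDistinct
    notBothDirect : ∀ {es es′ is is′} → All (_∉ es) es′ →
                    Trail G a b is es → Trail G a b is′ es′ → ¬ (is ≡ [] × is′ ≡ [])
    notBothDirect es#es′ (one e j) (one e′ j′) (refl , refl) =
      All.lookup es#es′ (here refl) (here (simple-joins-unique simple j j′))

petersenNeighbours : Fin 10 → List (Fin 10)
petersenNeighbours 0F = 1 ∷ 4 ∷ 5 ∷ []
petersenNeighbours 1F = 0 ∷ 2 ∷ 6 ∷ []
petersenNeighbours 2F = 1 ∷ 3 ∷ 7 ∷ []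
petersenNeighbours 3F = 2 ∷ 4 ∷ 8 ∷ []
petersenNeighbours 4F = 0 ∷ 3 ∷ 9 ∷ []
petersenNeighbours 5F = 0 ∷ 7 ∷ 8 ∷ []
petersenNeighbours 6F = 1 ∷ 8 ∷ 9 ∷ []
petersenNeighbours 7F = 2 ∷ 5 ∷ 9 ∷ []
petersenNeighbours 8F = 3 ∷ 5 ∷ 6 ∷ []
petersenNeighbours 9F = 4 ∷ 6 ∷ 7 ∷ []

petersen-noThetaBisubdivision : ¬ ThetaBisubdivision Petersen
petersen-noThetaBisubdivision =
  noThetaBisubdivision Petersen (from-yes (simple? Petersen))
    (from-yes (listsNeighbours? Petersen petersenNeighbours))
    (from-yes (noThetaShapes? petersenNeighbours))

walkFrom0 : ∀ x → Walk Petersen 0 x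
walkFrom0 0F = here
walkFrom0 1F = step 0 (inj₁ refl) here
walkFrom0 2F = step 0 (inj₁ refl) (step 1 (inj₁ refl) here)
walkFrom0 3F = step 4 (inj₂ refl) (step 3 (inj₂ refl) here)
walkFrom0 4F = step 4 (inj₂ refl) here
walkFrom0 5F = step 5 (inj₁ refl) here
walkFrom0 6F = step 0 (inj₁ refl) (step 6 (inj₁ refl) here)
walkFrom0 7F = step 5 (inj₁ refl) (step 10 (inj₁ refl) here)
walkFrom0 8F = step 5 (inj₁ refl) (step 14 (inj₂ refl) here)
walkFrom0 9F = step 4 (inj₂ refl) (step 9 (inj₁ refl) here)

petersenPerfectMatchings : List (List (Fin 15))
petersenPerfectMatchings =
    (0 ∷ 2 ∷ 9 ∷ 10 ∷ 13 ∷ [])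
  ∷ (0 ∷ 3 ∷ 7 ∷ 12 ∷ 14 ∷ [])
  ∷ (1 ∷ 3 ∷ 5 ∷ 11 ∷ 13 ∷ [])
  ∷ (1 ∷ 4 ∷ 8 ∷ 10 ∷ 12 ∷ [])
  ∷ (2 ∷ 4 ∷ 6 ∷ 11 ∷ 14 ∷ [])
  ∷ (5 ∷ 6 ∷ 7 ∷ 8 ∷ 9 ∷ [])
  ∷ []

petersen-matchingCovered : MatchingCovered Petersen
petersen-matchingCovered =
  connected-from Petersen 0 walkFrom0 , s≤s (s≤s z≤n) ,
  λ e → listed (Any.satisfied (everyEdgeMatched e))
  where
  EdgeIn : Fin 15 → List (Fin 15) → Set
  EdgeIn e M = IsPerfectMatching Petersen (edgeSet M) × edgeSet M e ≡ true

  everyEdgeMatched : ∀ e → Any (EdgeIn e) petersenPerfectMatchings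
  everyEdgeMatched = from-yes (all? λ e → Any.any?
    (λ M → perfectMatching? Petersen (edgeSet M) ×-dec (edgeSet M e ≟ᵇ true))
    petersenPerfectMatchings)

  listed : ∀ {e} → ∃ (EdgeIn e) → ∃ λ M → IsPerfectMatching Petersen M × M e ≡ true
  listed (M , e∈M) = edgeSet M , e∈M

-- One entry for each pair u < v, in lexicographic order, serving both ℙ + uv and ℙ + vu: a
-- θ-certificate and a perfect matching through the new edge uv. Edge 0 of ℙ + uv is uv and edge
-- k + 1 is edge k of ℙ.
petersen⁺Certificates : List (ThetaCertificate 10 16 × List (Fin 16))
petersen⁺Certificates =
    (certificate 0 1 [] [] (4 ∷ 3 ∷ 2 ∷ 7 ∷ 9 ∷ 6 ∷ [])
                 (0 ∷ []) (1 ∷ []) (5 ∷ 4 ∷ 3 ∷ 8 ∷ 12 ∷ 13 ∷ 7 ∷ [])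
                 (15 ∷ []) , (0 ∷ 3 ∷ 10 ∷ 11 ∷ 14 ∷ []))
  ∷ (certificate 0 2 [] (1 ∷ 6 ∷ 9 ∷ 7 ∷ []) (4 ∷ 3 ∷ [])
                 (0 ∷ []) (1 ∷ 7 ∷ 13 ∷ 12 ∷ 8 ∷ []) (5 ∷ 4 ∷ 3 ∷ [])
                 (15 ∷ []) , (0 ∷ 7 ∷ 4 ∷ 15 ∷ 12 ∷ []))
  ∷ (certificate 0 1 (3 ∷ 2 ∷ []) [] (4 ∷ 9 ∷ 7 ∷ 5 ∷ 8 ∷ 6 ∷ [])
                 (0 ∷ 3 ∷ 2 ∷ []) (1 ∷ []) (5 ∷ 10 ∷ 12 ∷ 11 ∷ 15 ∷ 14 ∷ 7 ∷ [])
                 [] , (0 ∷ 2 ∷ 10 ∷ 11 ∷ 14 ∷ []))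
  ∷ (certificate 0 4 [] (1 ∷ 2 ∷ 3 ∷ 8 ∷ 6 ∷ 9 ∷ []) []
                 (0 ∷ []) (1 ∷ 2 ∷ 3 ∷ 9 ∷ 14 ∷ 13 ∷ 10 ∷ []) (5 ∷ [])
                 (11 ∷ []) , (0 ∷ 2 ∷ 9 ∷ 11 ∷ 13 ∷ []))
  ∷ (certificate 0 5 [] (1 ∷ 2 ∷ 3 ∷ 4 ∷ 9 ∷ 7 ∷ []) []
                 (0 ∷ []) (1 ∷ 2 ∷ 3 ∷ 4 ∷ 10 ∷ 12 ∷ 11 ∷ []) (6 ∷ [])
                 (14 ∷ []) , (0 ∷ 2 ∷ 4 ∷ 14 ∷ 12 ∷ []))
  ∷ (certificate 0 3 (6 ∷ 8 ∷ []) (1 ∷ 2 ∷ []) (5 ∷ 7 ∷ 9 ∷ 4 ∷ [])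
                 (0 ∷ 14 ∷ 9 ∷ []) (1 ∷ 2 ∷ 3 ∷ []) (6 ∷ 11 ∷ 12 ∷ 10 ∷ 4 ∷ [])
                 [] , (0 ∷ 2 ∷ 4 ∷ 15 ∷ 12 ∷ []))
  ∷ (certificate 0 1 (7 ∷ 2 ∷ []) [] (5 ∷ 8 ∷ 3 ∷ 4 ∷ 9 ∷ 6 ∷ [])
                 (0 ∷ 8 ∷ 2 ∷ []) (1 ∷ []) (6 ∷ 15 ∷ 9 ∷ 4 ∷ 10 ∷ 13 ∷ 7 ∷ [])
                 [] , (0 ∷ 2 ∷ 4 ∷ 15 ∷ 13 ∷ []))
  ∷ (certificate 0 1 (8 ∷ 6 ∷ []) [] (5 ∷ 7 ∷ 9 ∷ 4 ∷ 3 ∷ 2 ∷ [])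
                 (0 ∷ 14 ∷ 7 ∷ []) (1 ∷ []) (6 ∷ 11 ∷ 12 ∷ 10 ∷ 4 ∷ 3 ∷ 2 ∷ [])
                 [] , (0 ∷ 2 ∷ 4 ∷ 11 ∷ 13 ∷ []))
  ∷ (certificate 0 1 (9 ∷ 6 ∷ []) [] (4 ∷ 3 ∷ 8 ∷ 5 ∷ 7 ∷ 2 ∷ [])
                 (0 ∷ 13 ∷ 7 ∷ []) (1 ∷ []) (5 ∷ 4 ∷ 9 ∷ 15 ∷ 11 ∷ 8 ∷ 2 ∷ [])
                 [] , (0 ∷ 2 ∷ 4 ∷ 11 ∷ 14 ∷ []))
  ∷ (certificate 1 2 [] (0 ∷ 4 ∷ 3 ∷ 8 ∷ 5 ∷ 7 ∷ []) []
                 (0 ∷ []) (1 ∷ 5 ∷ 4 ∷ 9 ∷ 15 ∷ 11 ∷ 8 ∷ []) (2 ∷ [])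
                 (13 ∷ []) , (0 ∷ 5 ∷ 9 ∷ 11 ∷ 13 ∷ []))
  ∷ (certificate 0 1 [] (4 ∷ 3 ∷ []) (5 ∷ 8 ∷ 6 ∷ 9 ∷ 7 ∷ 2 ∷ [])
                 (1 ∷ []) (5 ∷ 4 ∷ 0 ∷ []) (6 ∷ 15 ∷ 14 ∷ 13 ∷ 12 ∷ 8 ∷ 2 ∷ [])
                 [] , (0 ∷ 5 ∷ 8 ∷ 15 ∷ 13 ∷ []))
  ∷ (certificate 1 2 (4 ∷ 3 ∷ []) (0 ∷ 5 ∷ 8 ∷ 6 ∷ 9 ∷ 7 ∷ []) []
                 (0 ∷ 4 ∷ 3 ∷ []) (1 ∷ 6 ∷ 15 ∷ 14 ∷ 13 ∷ 12 ∷ 8 ∷ []) (2 ∷ [])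
                 [] , (0 ∷ 6 ∷ 3 ∷ 14 ∷ 12 ∷ []))
  ∷ (certificate 1 2 (5 ∷ 7 ∷ []) (0 ∷ 4 ∷ 9 ∷ 6 ∷ 8 ∷ 3 ∷ []) []
                 (0 ∷ 11 ∷ 8 ∷ []) (1 ∷ 5 ∷ 10 ∷ 13 ∷ 14 ∷ 9 ∷ 3 ∷ []) (2 ∷ [])
                 [] , (0 ∷ 5 ∷ 3 ∷ 14 ∷ 12 ∷ []))
  ∷ (certificate 1 6 [] (0 ∷ 4 ∷ 3 ∷ 2 ∷ 7 ∷ 9 ∷ []) []
                 (0 ∷ []) (1 ∷ 5 ∷ 4 ∷ 3 ∷ 8 ∷ 12 ∷ 13 ∷ []) (7 ∷ [])
                 (15 ∷ []) , (0 ∷ 5 ∷ 3 ∷ 15 ∷ 12 ∷ []))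
  ∷ (certificate 0 1 [] (4 ∷ 9 ∷ 6 ∷ 8 ∷ 3 ∷ 2 ∷ []) (5 ∷ 7 ∷ [])
                 (1 ∷ []) (5 ∷ 10 ∷ 13 ∷ 14 ∷ 9 ∷ 3 ∷ 2 ∷ []) (6 ∷ 11 ∷ 0 ∷ [])
                 [] , (0 ∷ 5 ∷ 3 ∷ 15 ∷ 13 ∷ []))
  ∷ (certificate 0 1 [] (4 ∷ 3 ∷ 2 ∷ 7 ∷ 9 ∷ 6 ∷ []) (5 ∷ 8 ∷ [])
                 (1 ∷ []) (5 ∷ 4 ∷ 3 ∷ 8 ∷ 12 ∷ 13 ∷ 7 ∷ []) (6 ∷ 15 ∷ 0 ∷ [])
                 [] , (0 ∷ 5 ∷ 3 ∷ 11 ∷ 13 ∷ []))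
  ∷ (certificate 0 1 [] (4 ∷ 9 ∷ []) (5 ∷ 7 ∷ 2 ∷ 3 ∷ 8 ∷ 6 ∷ [])
                 (1 ∷ []) (5 ∷ 10 ∷ 0 ∷ []) (6 ∷ 11 ∷ 8 ∷ 3 ∷ 9 ∷ 14 ∷ 7 ∷ [])
                 [] , (0 ∷ 5 ∷ 3 ∷ 11 ∷ 14 ∷ []))
  ∷ (certificate 2 3 [] (1 ∷ 0 ∷ 4 ∷ 9 ∷ 6 ∷ 8 ∷ []) []
                 (0 ∷ []) (2 ∷ 1 ∷ 5 ∷ 10 ∷ 13 ∷ 14 ∷ 9 ∷ []) (3 ∷ [])
                 (11 ∷ []) , (0 ∷ 1 ∷ 10 ∷ 11 ∷ 14 ∷ []))
  ∷ (certificate 0 1 [] (4 ∷ 2 ∷ []) (5 ∷ 7 ∷ 9 ∷ 6 ∷ [])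
                 (1 ∷ []) (5 ∷ 0 ∷ 2 ∷ []) (6 ∷ 11 ∷ 12 ∷ 13 ∷ 7 ∷ [])
                 (9 ∷ []) , (0 ∷ 1 ∷ 9 ∷ 11 ∷ 13 ∷ []))
  ∷ (certificate 0 1 [] (4 ∷ 3 ∷ 8 ∷ 6 ∷ []) (5 ∷ 2 ∷ [])
                 (1 ∷ []) (5 ∷ 4 ∷ 9 ∷ 14 ∷ 7 ∷ []) (6 ∷ 0 ∷ 2 ∷ [])
                 (12 ∷ []) , (0 ∷ 1 ∷ 4 ∷ 14 ∷ 12 ∷ []))
  ∷ (certificate 2 3 (6 ∷ 8 ∷ []) (1 ∷ 0 ∷ 5 ∷ 7 ∷ 9 ∷ 4 ∷ []) []
                 (0 ∷ 14 ∷ 9 ∷ []) (2 ∷ 1 ∷ 6 ∷ 11 ∷ 12 ∷ 10 ∷ 4 ∷ []) (3 ∷ [])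
                 [] , (0 ∷ 1 ∷ 4 ∷ 15 ∷ 12 ∷ []))
  ∷ (certificate 2 7 [] (1 ∷ 0 ∷ 4 ∷ 3 ∷ 8 ∷ 5 ∷ []) []
                 (0 ∷ []) (2 ∷ 1 ∷ 5 ∷ 4 ∷ 9 ∷ 15 ∷ 11 ∷ []) (8 ∷ [])
                 (13 ∷ []) , (0 ∷ 1 ∷ 4 ∷ 15 ∷ 13 ∷ []))
  ∷ (certificate 0 1 [] (4 ∷ 3 ∷ 8 ∷ 2 ∷ []) (5 ∷ 7 ∷ 9 ∷ 6 ∷ [])
                 (1 ∷ []) (5 ∷ 4 ∷ 9 ∷ 0 ∷ 2 ∷ []) (6 ∷ 11 ∷ 12 ∷ 13 ∷ 7 ∷ [])
                 [] , (0 ∷ 1 ∷ 4 ∷ 11 ∷ 13 ∷ []))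
  ∷ (certificate 0 1 [] (4 ∷ 3 ∷ 8 ∷ 6 ∷ []) (5 ∷ 7 ∷ 9 ∷ 2 ∷ [])
                 (1 ∷ []) (5 ∷ 4 ∷ 9 ∷ 14 ∷ 7 ∷ []) (6 ∷ 11 ∷ 12 ∷ 0 ∷ 2 ∷ [])
                 [] , (0 ∷ 1 ∷ 4 ∷ 11 ∷ 14 ∷ []))
  ∷ (certificate 3 4 [] (2 ∷ 1 ∷ 0 ∷ 5 ∷ 7 ∷ 9 ∷ []) []
                 (0 ∷ []) (3 ∷ 2 ∷ 1 ∷ 6 ∷ 11 ∷ 12 ∷ 10 ∷ []) (4 ∷ [])
                 (14 ∷ []) , (0 ∷ 1 ∷ 8 ∷ 15 ∷ 13 ∷ []))
  ∷ (certificate 0 1 [] (4 ∷ 9 ∷ 7 ∷ 2 ∷ []) (5 ∷ 3 ∷ 8 ∷ 6 ∷ [])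
                 (1 ∷ []) (5 ∷ 10 ∷ 12 ∷ 8 ∷ 2 ∷ []) (6 ∷ 0 ∷ 9 ∷ 14 ∷ 7 ∷ [])
                 [] , (0 ∷ 1 ∷ 8 ∷ 10 ∷ 14 ∷ []))
  ∷ (certificate 0 1 [] (4 ∷ 9 ∷ 7 ∷ 2 ∷ []) (5 ∷ 8 ∷ 3 ∷ 6 ∷ [])
                 (1 ∷ []) (5 ∷ 10 ∷ 12 ∷ 8 ∷ 2 ∷ []) (6 ∷ 15 ∷ 9 ∷ 0 ∷ 7 ∷ [])
                 [] , (0 ∷ 1 ∷ 8 ∷ 10 ∷ 15 ∷ []))
  ∷ (certificate 0 3 (1 ∷ 2 ∷ []) (4 ∷ 9 ∷ 6 ∷ 8 ∷ []) (5 ∷ 7 ∷ [])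
                 (1 ∷ 2 ∷ 3 ∷ []) (5 ∷ 10 ∷ 13 ∷ 14 ∷ 9 ∷ []) (6 ∷ 11 ∷ 0 ∷ [])
                 [] , (0 ∷ 5 ∷ 2 ∷ 15 ∷ 13 ∷ []))
  ∷ (certificate 3 8 [] (2 ∷ 1 ∷ 0 ∷ 4 ∷ 9 ∷ 6 ∷ []) []
                 (0 ∷ []) (3 ∷ 2 ∷ 1 ∷ 5 ∷ 10 ∷ 13 ∷ 14 ∷ []) (9 ∷ [])
                 (11 ∷ []) , (0 ∷ 5 ∷ 2 ∷ 11 ∷ 13 ∷ []))
  ∷ (certificate 1 2 (0 ∷ 4 ∷ 9 ∷ 3 ∷ []) [] (6 ∷ 8 ∷ 5 ∷ 7 ∷ [])
                 (1 ∷ 5 ∷ 10 ∷ 0 ∷ 3 ∷ []) (2 ∷ []) (7 ∷ 14 ∷ 15 ∷ 11 ∷ 8 ∷ [])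
                 [] , (0 ∷ 5 ∷ 2 ∷ 11 ∷ 14 ∷ []))
  ∷ (certificate 2 3 (1 ∷ 0 ∷ 5 ∷ 4 ∷ []) [] (7 ∷ 9 ∷ 6 ∷ 8 ∷ [])
                 (2 ∷ 1 ∷ 6 ∷ 0 ∷ 4 ∷ []) (3 ∷ []) (8 ∷ 12 ∷ 13 ∷ 14 ∷ 9 ∷ [])
                 [] , (0 ∷ 1 ∷ 3 ∷ 14 ∷ 12 ∷ []))
  ∷ (certificate 0 1 [] (4 ∷ 6 ∷ []) (5 ∷ 8 ∷ 3 ∷ 2 ∷ [])
                 (1 ∷ []) (5 ∷ 0 ∷ 7 ∷ []) (6 ∷ 15 ∷ 9 ∷ 3 ∷ 2 ∷ [])
                 (12 ∷ []) , (0 ∷ 1 ∷ 3 ∷ 15 ∷ 12 ∷ []))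
  ∷ (certificate 0 1 [] (4 ∷ 7 ∷ 9 ∷ 6 ∷ []) (5 ∷ 8 ∷ 3 ∷ 2 ∷ [])
                 (1 ∷ []) (5 ∷ 0 ∷ 12 ∷ 13 ∷ 7 ∷ []) (6 ∷ 15 ∷ 9 ∷ 3 ∷ 2 ∷ [])
                 [] , (0 ∷ 1 ∷ 3 ∷ 15 ∷ 13 ∷ []))
  ∷ (certificate 0 1 [] (4 ∷ 8 ∷ 3 ∷ 2 ∷ []) (5 ∷ 7 ∷ 9 ∷ 6 ∷ [])
                 (1 ∷ []) (5 ∷ 0 ∷ 9 ∷ 3 ∷ 2 ∷ []) (6 ∷ 11 ∷ 12 ∷ 13 ∷ 7 ∷ [])
                 [] , (0 ∷ 1 ∷ 3 ∷ 11 ∷ 13 ∷ []))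
  ∷ (certificate 4 9 [] (3 ∷ 2 ∷ 1 ∷ 0 ∷ 5 ∷ 7 ∷ []) []
                 (0 ∷ []) (4 ∷ 3 ∷ 2 ∷ 1 ∷ 6 ∷ 11 ∷ 12 ∷ []) (10 ∷ [])
                 (14 ∷ []) , (0 ∷ 1 ∷ 3 ∷ 11 ∷ 14 ∷ []))
  ∷ (certificate 0 1 [] (4 ∷ 9 ∷ 7 ∷ 2 ∷ []) (5 ∷ 6 ∷ [])
                 (1 ∷ []) (5 ∷ 10 ∷ 12 ∷ 8 ∷ 2 ∷ []) (6 ∷ 0 ∷ 7 ∷ [])
                 (9 ∷ []) , (0 ∷ 1 ∷ 8 ∷ 9 ∷ 10 ∷ []))
  ∷ (certificate 5 7 [] (0 ∷ 1 ∷ 2 ∷ 3 ∷ 4 ∷ 9 ∷ []) []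
                 (0 ∷ []) (6 ∷ 1 ∷ 2 ∷ 3 ∷ 4 ∷ 10 ∷ 12 ∷ []) (11 ∷ [])
                 (14 ∷ []) , (0 ∷ 1 ∷ 3 ∷ 10 ∷ 14 ∷ []))
  ∷ (certificate 5 8 [] (0 ∷ 1 ∷ 2 ∷ 7 ∷ 9 ∷ 6 ∷ []) []
                 (0 ∷ []) (6 ∷ 1 ∷ 2 ∷ 8 ∷ 12 ∷ 13 ∷ 14 ∷ []) (15 ∷ [])
                 (4 ∷ []) , (0 ∷ 1 ∷ 8 ∷ 4 ∷ 13 ∷ []))
  ∷ (certificate 0 1 [] (4 ∷ 3 ∷ 8 ∷ 6 ∷ []) (5 ∷ 9 ∷ 7 ∷ 2 ∷ [])
                 (1 ∷ []) (5 ∷ 4 ∷ 9 ∷ 14 ∷ 7 ∷ []) (6 ∷ 0 ∷ 12 ∷ 8 ∷ 2 ∷ [])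
                 [] , (0 ∷ 1 ∷ 8 ∷ 4 ∷ 14 ∷ []))
  ∷ (certificate 0 1 [] (4 ∷ 9 ∷ 7 ∷ 6 ∷ []) (5 ∷ 8 ∷ 3 ∷ 2 ∷ [])
                 (1 ∷ []) (5 ∷ 10 ∷ 12 ∷ 0 ∷ 7 ∷ []) (6 ∷ 15 ∷ 9 ∷ 3 ∷ 2 ∷ [])
                 [] , (0 ∷ 1 ∷ 3 ∷ 10 ∷ 15 ∷ []))
  ∷ (certificate 6 8 [] (1 ∷ 0 ∷ 4 ∷ 9 ∷ 7 ∷ 5 ∷ []) []
                 (0 ∷ []) (7 ∷ 1 ∷ 5 ∷ 10 ∷ 12 ∷ 11 ∷ 15 ∷ []) (14 ∷ [])
                 (3 ∷ []) , (0 ∷ 1 ∷ 3 ∷ 10 ∷ 11 ∷ []))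
  ∷ (certificate 6 9 [] (1 ∷ 0 ∷ 4 ∷ 3 ∷ 2 ∷ 7 ∷ []) []
                 (0 ∷ []) (7 ∷ 1 ∷ 5 ∷ 4 ∷ 3 ∷ 8 ∷ 12 ∷ []) (13 ∷ [])
                 (15 ∷ []) , (0 ∷ 1 ∷ 8 ∷ 4 ∷ 15 ∷ []))
  ∷ (certificate 1 2 (0 ∷ 5 ∷ 8 ∷ 7 ∷ []) [] (6 ∷ 9 ∷ 4 ∷ 3 ∷ [])
                 (1 ∷ 6 ∷ 15 ∷ 0 ∷ 8 ∷ []) (2 ∷ []) (7 ∷ 13 ∷ 10 ∷ 4 ∷ 3 ∷ [])
                 [] , (0 ∷ 6 ∷ 2 ∷ 4 ∷ 13 ∷ []))
  ∷ (certificate 7 9 [] (2 ∷ 1 ∷ 0 ∷ 5 ∷ 8 ∷ 6 ∷ []) []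
                 (0 ∷ []) (8 ∷ 2 ∷ 1 ∷ 6 ∷ 15 ∷ 14 ∷ 13 ∷ []) (12 ∷ [])
                 (4 ∷ []) , (0 ∷ 5 ∷ 7 ∷ 3 ∷ 15 ∷ []))
  ∷ (certificate 0 4 (1 ∷ 6 ∷ 8 ∷ 9 ∷ []) [] (5 ∷ 7 ∷ 2 ∷ 3 ∷ [])
                 (1 ∷ 7 ∷ 14 ∷ 0 ∷ 10 ∷ []) (5 ∷ []) (6 ∷ 11 ∷ 8 ∷ 3 ∷ 4 ∷ [])
                 [] , (0 ∷ 5 ∷ 7 ∷ 3 ∷ 11 ∷ []))
  ∷ []

petersen⁺-certified : ∀ u v (u≢v : u ≢ v) →
                      Any (CertifiesThetaBased Petersen u≢v) petersen⁺Certificates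
petersen⁺-certified = from-yes (∀≢? (Any.map (certifiesThetaBased-irrelevant Petersen))
  λ u≢v → Any.any? (certifiesThetaBased? Petersen u≢v) petersen⁺Certificates)

proposition14 : ThetaFree Petersen ×
    ((u v : Fin 10) → (u≢v : u ≢ v) → ThetaBased (addEdge Petersen u v u≢v))
proposition14 =
  (petersen-matchingCovered , λ (H , _) → petersen-noThetaBisubdivision H) ,
  λ u v u≢v → certified-thetaBased Petersen u≢v petersen-matchingCovered
                (proj₂ (Any.satisfied (petersen⁺-certified u v u≢v)))
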